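{- Let $M$ be a transversal matroid of rank $r$ and let $\mathcal{A}=(A_i:i\in[r])$ and $\mathcal{B}=(B_i:i\in[r])$ be presentations of $M$ with $\mathcal{A}\preceq\mathcal{B}$. Then $L_\mathcal{B}$ is a sublattice of $L_\mathcal{A}$, and $M[\mathcal{A}^I]=M[\mathcal{B}^I]$ for all $I\in L_\mathcal{B}$.
   Context: $[r]=\{1,\dots,r\}$. For a set system $\mathcal{A}=(A_i:i\in[r])$ on a finite set $E$, $M[\mathcal{A}]$ is the transversal matroid on $E$ whose independent sets are the partial transversals of $\mathcal{A}$ (sets $X\subseteq E$ admitting an injection $\phi:X\to[r]$ with $e\in A_{\phi(e)}$); $\mathcal{A}$ is a presentation of $M[\mathcal{A}]$. Presentations of a rank-$r$ transversal matroid are taken to have exactly $r$ sets. For presentations $\mathcal{A},\mathcal{B}$ of the same matroid, $\mathcal{A}\preceq\mathcal{B}$ means $A_i\subseteq B_i$ for all $i\in[r]$. Fix $x\notin E$; for $I\subseteq[r]$, $\mathcal{A}^I$ is obtained by replacing $A_i$ by $A_i\cup\{x\}$ for each $i\in I$. Let $\sigma_\mathcal{A}(I)=I\cup\{k\in[r]-I: x\text{ is a coloop of } M[\mathcal{A}^I]\backslash A_k\}$; $L_\mathcal{A}$ is the lattice (under inclusion, with join $\cup$ and meet $\cap$) of sets $I\subseteq[r]$ with $\sigma_\mathcal{A}(I)=I$. Similarly for $\mathcal{B}$. -}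

module Defs where

open import Data.Nat using (ℕ; suc)
open import Data.Fin using (Fin; zero; suc)
open import Data.Fin.Subset using (Subset; _∈_; _∉_; _⊆_; _∪_; _∩_; ∁; ∣_∣; inside; outside)
open import Data.Vec using (_∷_; lookup)
open import Data.Product using (Σ; ∃; _×_; _,_)
open import Data.Sum using (_⊎_)
open import Relation.Binary.PropositionalEquality using (_≡_)
open import Relation.Nullary using (¬_)
open import Function.Bundles using (_⇔_)

SetSystem : ℕ → ℕ → Set
SetSystem r n = Fin r → Subset n

Indep : ∀ {r n} → SetSystem r n → Subset n → Set
Indep {r} {n} 𝒜 X =
  Σ (Fin n → Fin r) λ φ →
    (∀ e → e ∈ X → e ∈ 𝒜 (φ e)) ×
    (∀ e f → e ∈ X → f ∈ X → φ e ≡ φ f → e ≡ f)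

SameMatroid : ∀ {r r' n} → SetSystem r n → SetSystem r' n → Set
SameMatroid 𝒜 ℬ = ∀ X → Indep 𝒜 X ⇔ Indep ℬ X

HasRank : ∀ {r n} → SetSystem r n → ℕ → Set
HasRank 𝒜 k = ∃ λ X → Indep 𝒜 X × ∣ X ∣ ≡ k

_⪯_ : ∀ {r n} → SetSystem r n → SetSystem r n → Set
𝒜 ⪯ ℬ = ∀ i → 𝒜 i ⊆ ℬ i

-- Ground set E ∪ {x} is Fin (suc n): x = zero, e ∈ E is suc e.
xElt : ∀ {n} → Fin (suc n)
xElt = zero

-- 𝒜^I : replace A_i by A_i ∪ {x} for i ∈ I.
_^_ : ∀ {r n} → SetSystem r n → Subset r → SetSystem r (suc n)
(𝒜 ^ I) i = lookup I i ∷ 𝒜 i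

IsBasisIn : ∀ {m} → (Subset m → Set) → Subset m → Subset m → Set
IsBasisIn Ind S X =
  X ⊆ S × Ind X × (∀ Y → X ⊆ Y → Y ⊆ S → Ind Y → Y ⊆ X)

IsColoopIn : ∀ {m} → (Subset m → Set) → Subset m → Fin m → Set
IsColoopIn Ind S e = e ∈ S × (∀ X → IsBasisIn Ind S X → e ∈ X)

-- x is a coloop of M[𝒜^I] \ A_k  (ground set (E ∪ {x}) − A_k).
XColoopDel : ∀ {r n} → SetSystem r n → Subset r → Fin r → Set
XColoopDel 𝒜 I k =
  IsColoopIn (Indep (𝒜 ^ I)) (∁ (outside ∷ 𝒜 k)) xElt

_∈σ[_]_ : ∀ {r n} → Fin r → SetSystem r n → Subset r → Set
k ∈σ[ 𝒜 ] I = k ∈ I ⊎ (k ∉ I × XColoopDel 𝒜 I k)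

InL : ∀ {r n} → SetSystem r n → Subset r → Set
InL 𝒜 I = ∀ k → (k ∈σ[ 𝒜 ] I) ⇔ (k ∈ I)

-- Independent sets are the sets admitting a matching, and the argument rests
-- on two exchange principles for matchings: greedy extension of independent
-- sets to bases, and the alternating-path lemma comparing two matchings.
-- From these follows Bondy's lemma: adding to P j an element that is a coloop
-- of M[P] \ P j does not change M[P].
-- Coloops are handled through spanning witnesses: x is not a coloop of
-- M[C ^ I] \ C k iff (up to double negation) some x-free independent set of
-- the deletion spans x.  Witnesses move from ℬ to 𝒜 (so L_ℬ ⊆ L_𝒜), from I to
-- subsets of I (meets), and, by an alternating path, from I and J to I ∪ J
-- (joins).  Finally M[𝒜 ^ I] = M[ℬ ^ I] follows by adding the elements of ℬ
-- missing from 𝒜 one at a time: every intermediate system presents the same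
-- matroid and has I in its lattice, so each step is an instance of Bondy's
-- lemma for C ^ I.

module Submission where

open import Defs
open import Data.Nat using (ℕ)
open import Data.Fin.Subset using (Subset; _∪_; _∩_)
open import Data.Product using (_×_)

open import Data.Nat using (zero; suc; _+_; _≤_; _<_; _∸_)
import Data.Nat.Properties as ℕₚ
open import Data.Nat.Induction using (<-wellFounded)
open import Data.Fin using (Fin; zero; suc; _≟_)
open import Data.Fin.Properties using (any?; all?; suc-injective)
open import Data.Fin.Subset using (_∈_; _∉_; _⊆_; _⊂_; _⊃_; _-_; _─_; ⁅_⁆; ∁; ∣_∣; inside; outside) renaming (⊥ to ∅)
open import Data.Fin.Subset.Properties
open import Data.Fin.Subset.Induction using (⊂-wellFounded; ⊃-wellFounded)
open import Induction.WellFounded using (Acc; acc)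
open import Data.Vec using (_∷_; lookup; here; there)
open import Data.Vec.Properties using ([]=⇒lookup; lookup⇒[]=)
open import Data.Vec.Functional using (updateAt) renaming (_∷_ to _∷ᶠ_)
open import Data.Vec.Functional.Properties using (updateAt-updates; updateAt-minimal)
open import Data.Product using (Σ; ∃; _,_; proj₁; proj₂)
open import Data.Sum using (_⊎_; inj₁; inj₂; [_,_])
open import Data.Empty using (⊥; ⊥-elim)
open import Data.Unit using (⊤; tt)
open import Relation.Nullary using (¬_; Dec; yes; no)
open import Relation.Nullary.Decidable using (_×-dec_; _→-dec_; ¬?)
open import Relation.Binary.PropositionalEquality using (_≡_; _≢_; refl; sym; trans; cong; subst)
open import Function.Bundles using (mk⇔; Equivalence)

private
  variable
    m : ℕ
    X : Subset m

⊆-insert : ∀ {y} → X ⊆ X ∪ ⁅ y ⁆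
⊆-insert = p⊆p∪q _

∈-insert-new : ∀ {y} → y ∈ X ∪ ⁅ y ⁆
∈-insert-new {y = y} = x∈p∪q⁺ (inj₂ (x∈⁅x⁆ y))

∈-insert⁻ : ∀ {x y} → x ∈ X ∪ ⁅ y ⁆ → x ∈ X ⊎ x ≡ y
∈-insert⁻ {y = y} h with x∈p∪q⁻ _ ⁅ y ⁆ h
... | inj₁ x∈X = inj₁ x∈X
... | inj₂ x∈y = inj₂ (x∈⁅y⁆⇒x≡y y x∈y)

insert-⊆ : ∀ {S y} → X ⊆ S → y ∈ S → X ∪ ⁅ y ⁆ ⊆ S
insert-⊆ X⊆S y∈S h with ∈-insert⁻ h
... | inj₁ x∈X = X⊆S x∈X
... | inj₂ refl = y∈S

∈-remove⁻ : ∀ {x y} → x ∈ X - y → x ∈ X × x ≢ y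
∈-remove⁻ {y = y} h = p─q⊆p _ ⁅ y ⁆ h , λ { refl → x∈p─q⇒x∉q _ ⁅ y ⁆ h (x∈⁅x⁆ y) }
  where
  x∈p─q⇒x∉q : ∀ {k} (p q : Subset k) {x} → x ∈ p ─ q → x ∉ q
  x∈p─q⇒x∉q (inside ∷ p) (outside ∷ q) here ()
  x∈p─q⇒x∉q (_ ∷ p) (_ ∷ q) (there h) (there h') = x∈p─q⇒x∉q p q h h'

⊆-remove-insert : ∀ {y} → X ⊆ (X - y) ∪ ⁅ y ⁆
⊆-remove-insert {y = y} {x} h with x ≟ y
... | yes refl = ∈-insert-new
... | no x≢y = ⊆-insert (x∈p∧x≢y⇒x∈p-y h x≢y)

_[_≔_] : ∀ {A : Set} → (Fin m → A) → Fin m → A → Fin m → A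
φ [ y ≔ v ] = updateAt φ y (λ _ → v)

-- The
-- predicate R records which sets ("slots") the matching is allowed to use.

Match : ∀ {r} → SetSystem r m → Subset m → (Fin m → Fin r) → Set
Match C Z φ = (∀ e → e ∈ Z → e ∈ C (φ e)) × (∀ e f → e ∈ Z → f ∈ Z → φ e ≡ φ f → e ≡ f)

record MatchIn {r} (C : SetSystem r m) (R : Fin r → Set) (Z : Subset m) (φ : Fin m → Fin r) : Set where
  constructor _▸_
  field
    match : Match C Z φ
    uses  : ∀ e → e ∈ Z → R (φ e)
open MatchIn public

IndepIn : ∀ {r} → SetSystem r m → (Fin r → Set) → Subset m → Set
IndepIn C R Z = ∃ (MatchIn C R Z)

_without_ : ∀ {r} → (Fin r → Set) → Fin r → Fin r → Set
(R without j) t = R t × t ≢ j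

Anything : ∀ {r} → Fin r → Set
Anything _ = ⊤

module _ {r : ℕ} {C : SetSystem r m} where

  match-⊆ : ∀ {Z Z' φ} → Z' ⊆ Z → Match C Z φ → Match C Z' φ
  match-⊆ Z'⊆Z (mem , inj) = (λ e h → mem e (Z'⊆Z h)) , λ e f he hf → inj e f (Z'⊆Z he) (Z'⊆Z hf)

  indep-⊆ : ∀ {Z Z'} → Z' ⊆ Z → Indep C Z → Indep C Z'
  indep-⊆ Z'⊆Z (φ , mφ) = φ , match-⊆ Z'⊆Z mφ

  within-⊆ : ∀ {R Z Z' φ} → Z' ⊆ Z → MatchIn C R Z φ → MatchIn C R Z' φ
  within-⊆ Z'⊆Z (mφ ▸ img) = match-⊆ Z'⊆Z mφ ▸ λ e h → img e (Z'⊆Z h)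

  within-weaken : ∀ {R R' : Fin r → Set} {Z φ} → (∀ {t} → R t → R' t) → MatchIn C R Z φ → MatchIn C R' Z φ
  within-weaken R⇒R' (mφ ▸ img) = mφ ▸ λ e h → R⇒R' (img e h)

  extend-match : ∀ {R Z Z' φ y v} → MatchIn C (R without v) Z φ → y ∈ C v → R v
    → Z' ⊆ Z ∪ ⁅ y ⁆ → MatchIn C R Z' (φ [ y ≔ v ])
  extend-match {R} {Z} {Z'} {φ} {y} {v} ((mem , inj) ▸ img) y∈Cv Rv Z'⊆ = (mem' , inj') ▸ img'
    where
    φ' = φ [ y ≔ v ]
    at-y : φ' y ≡ v
    at-y = updateAt-updates y φ
    off-y : ∀ {e} → e ≢ y → φ' e ≡ φ e
    off-y e≢y = updateAt-minimal _ y φ e≢y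
    old : ∀ {e} → e ∈ Z' → e ≢ y → e ∈ Z
    old h e≢y = [ (λ e∈Z → e∈Z) , (λ e≡y → ⊥-elim (e≢y e≡y)) ] (∈-insert⁻ (Z'⊆ h))
    mem' : ∀ e → e ∈ Z' → e ∈ C (φ' e)
    mem' e h with e ≟ y
    ... | yes refl = subst (λ t → e ∈ C t) (sym at-y) y∈Cv
    ... | no e≢y = subst (λ t → e ∈ C t) (sym (off-y e≢y)) (mem e (old h e≢y))
    img' : ∀ e → e ∈ Z' → R (φ' e)
    img' e h with e ≟ y
    ... | yes refl = subst R (sym at-y) Rv
    ... | no e≢y = subst R (sym (off-y e≢y)) (proj₁ (img e (old h e≢y)))
    inj' : ∀ e f → e ∈ Z' → f ∈ Z' → φ' e ≡ φ' f → e ≡ f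
    inj' e f he hf eq with e ≟ y | f ≟ y
    ... | yes e≡y | yes f≡y = trans e≡y (sym f≡y)
    ... | yes refl | no f≢y = ⊥-elim (proj₂ (img f (old hf f≢y)) (trans (sym (off-y f≢y)) (trans (sym eq) at-y)))
    ... | no e≢y | yes refl = ⊥-elim (proj₂ (img e (old he e≢y)) (trans (sym (off-y e≢y)) (trans eq at-y)))
    ... | no e≢y | no f≢y = inj e f (old he e≢y) (old hf f≢y) (trans (sym (off-y e≢y)) (trans eq (off-y f≢y)))

  remove-slot : ∀ {R Z φ y j} → MatchIn C R Z φ → y ∈ Z → φ y ≡ j → MatchIn C (R without j) (Z - y) φ
  remove-slot {R} {Z} {y = y} ((mem , inj) ▸ img) y∈Z φy≡j =
    match-⊆ (p─q⊆p Z ⁅ y ⁆) (mem , inj) ▸ λ e h →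
      img e (proj₁ (∈-remove⁻ h)) , λ φe≡j → proj₂ (∈-remove⁻ h) (inj e y (proj₁ (∈-remove⁻ h)) y∈Z (trans φe≡j (sym φy≡j)))

  add-avoid : ∀ {R Z φ v} → MatchIn C R Z φ → (∀ e → e ∈ Z → φ e ≢ v) → MatchIn C (R without v) Z φ
  add-avoid (mφ ▸ img) avoids = mφ ▸ λ e h → img e h , avoids e h

match-mono : ∀ {r} {C D : SetSystem r m} {Z φ} → C ⪯ D → Match C Z φ → Match D Z φ
match-mono C⪯D (mem , inj) = (λ e h → C⪯D _ (mem e h)) , inj

indep-mono : ∀ {r} {C D : SetSystem r m} {Z} → C ⪯ D → Indep C Z → Indep D Z
indep-mono C⪯D (φ , mφ) = φ , match-mono C⪯D mφ

-- Independence in a transversal matroid is decidable: a matching is a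
-- function between finite sets, and these can be enumerated.

∃-fun? : ∀ {r} n (P : (Fin n → Fin r) → Set) → (∀ f → Dec (P f))
  → (∀ f g → (∀ i → f i ≡ g i) → P f → P g) → Dec (∃ P)
∃-fun? zero P P? P-ext with P? (λ ())
... | yes p = yes (_ , p)
... | no ¬p = no λ (f , pf) → ¬p (P-ext f _ (λ ()) pf)
∃-fun? (suc n) P P? P-ext
  with any? (λ i → ∃-fun? n (λ g → P (i ∷ᶠ g)) (λ g → P? (i ∷ᶠ g))
                     (λ f g f≗g → P-ext _ _ λ { zero → refl ; (suc k) → f≗g k }))
... | yes (_ , _ , p) = yes (_ , p)
... | no ¬p = no λ (f , pf) → ¬p (f zero , (λ k → f (suc k)) , P-ext f _ (λ { zero → refl ; (suc k) → refl }) pf)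

indep? : ∀ {r} (C : SetSystem r m) Z → Dec (Indep C Z)
indep? {m} C Z = ∃-fun? m (Match C Z) match? match-ext
  where
  match? : ∀ φ → Dec (Match C Z φ)
  match? φ = all? (λ e → (e ∈? Z) →-dec (e ∈? C (φ e)))
    ×-dec all? (λ e → all? (λ f → (e ∈? Z) →-dec ((f ∈? Z) →-dec ((φ e ≟ φ f) →-dec (e ≟ f)))))
  match-ext : ∀ φ ψ → (∀ i → φ i ≡ ψ i) → Match C Z φ → Match C Z ψ
  match-ext φ ψ φ≗ψ (mem , inj) = (λ e h → subst (λ t → e ∈ C t) (φ≗ψ e) (mem e h))
    , λ e f he hf eq → inj e f he hf (trans (φ≗ψ e) (trans eq (sym (φ≗ψ f))))

basis-absorbs : ∀ {Ind : Subset m → Set} {S B y} → IsBasisIn Ind S B → y ∈ S → Ind (B ∪ ⁅ y ⁆) → y ∈ B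
basis-absorbs (B⊆S , _ , maximal) y∈S ind = maximal _ ⊆-insert (insert-⊆ B⊆S y∈S) ind ∈-insert-new

module _ (Ind : Subset m → Set) (ind? : ∀ Z → Dec (Ind Z))
         (hereditary : ∀ {Z Z'} → Z' ⊆ Z → Ind Z → Ind Z') where

  extend-to-basis : ∀ S Y → Y ⊆ S → Ind Y → Σ (Subset m) λ B → Y ⊆ B × IsBasisIn Ind S B
  extend-to-basis S Y = go Y (⊃-wellFounded Y)
    where
    go : ∀ Y → Acc _⊃_ Y → Y ⊆ S → Ind Y → Σ (Subset m) λ B → Y ⊆ B × IsBasisIn Ind S B
    go Y (acc rec) Y⊆S indY with any? (λ e → (e ∈? S) ×-dec (¬? (e ∈? Y) ×-dec ind? (Y ∪ ⁅ e ⁆)))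
    ... | yes (e , e∈S , e∉Y , indYe) with go (Y ∪ ⁅ e ⁆) (rec (⊆-insert , e , ∈-insert-new , e∉Y)) (insert-⊆ Y⊆S e∈S) indYe
    ...   | B , Ye⊆B , basis = B , (λ h → Ye⊆B (⊆-insert h)) , basis
    go Y _ Y⊆S indY | no ¬e = Y , (λ h → h) , Y⊆S , indY , maximal
      where
      maximal : ∀ W → Y ⊆ W → W ⊆ S → Ind W → W ⊆ Y
      maximal W Y⊆W W⊆S indW {x} x∈W with x ∈? Y
      ... | yes x∈Y = x∈Y
      ... | no x∉Y = ⊥-elim (¬e (x , W⊆S x∈W , x∉Y , hereditary (insert-⊆ Y⊆W x∈W) indW))

basis-of : ∀ {r} (C : SetSystem r m) S Y → Y ⊆ S → Indep C Y → Σ (Subset m) λ B → Y ⊆ B × IsBasisIn (Indep C) S B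
basis-of C = extend-to-basis (Indep C) (indep? C) (indep-⊆ {C = C})

-- Let φ match X without using slot j, and let
-- ψ match Y with ψ y₀ = j.  Following the path y₀, φ y₀, ψ⁻¹ (φ y₀), ...
-- either rematches Y without j, or reaches some y ∈ Y - X; in the latter case
-- X ∪ {y} is matched and Y - y is matched without j.

Augmentation : ∀ {r} → SetSystem r m → (Fin r → Set) → Subset m → Subset m → Fin r → Set
Augmentation C R X Y j =
  IndepIn C (R without j) Y
  ⊎ (∃ λ y → y ∈ Y × y ∉ X × IndepIn C R (X ∪ ⁅ y ⁆) × IndepIn C (R without j) (Y - y))

insert-remove-swap : ∀ {y z} → X ∪ ⁅ y ⁆ ⊆ ((X - z) ∪ ⁅ y ⁆) ∪ ⁅ z ⁆
insert-remove-swap {X = X} {y} {z} = insert-⊆ X⊆ (⊆-insert ∈-insert-new)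
  where
  X⊆ : X ⊆ ((X - z) ∪ ⁅ y ⁆) ∪ ⁅ z ⁆
  X⊆ {x} x∈X with x ≟ z
  ... | yes refl = ∈-insert-new
  ... | no x≢z = ⊆-insert (⊆-insert (x∈p∧x≢y⇒x∈p-y x∈X x≢z))

module _ {r : ℕ} {C : SetSystem r m} where

  alternating-path : ∀ R X Y {φ ψ j y₀} → MatchIn C (R without j) X φ → MatchIn C R Y ψ
    → y₀ ∈ Y → ψ y₀ ≡ j → Augmentation C R X Y j
  alternating-path R X = go R X (⊂-wellFounded X)
    where
    go : ∀ R X → Acc _⊂_ X → ∀ Y {φ ψ j y₀} → MatchIn C (R without j) X φ → MatchIn C R Y ψ
      → y₀ ∈ Y → ψ y₀ ≡ j → Augmentation C R X Y j
    go R X (acc rec) Y {φ} {ψ} {j} {y₀} mφ mψ y₀∈Y ψy₀≡j with y₀ ∈? X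
    ... | no y₀∉X = inj₂ (y₀ , y₀∈Y , y₀∉X , (φ [ y₀ ≔ j ] , extend-match mφ y₀∈Cj Rj ⊆-refl)
                         , (ψ , remove-slot mψ y₀∈Y ψy₀≡j))
      where
      y₀∈Cj = subst (λ t → y₀ ∈ C t) ψy₀≡j (proj₁ (match mψ) y₀ y₀∈Y)
      Rj = subst R ψy₀≡j (uses mψ y₀ y₀∈Y)
    ... | yes y₀∈X with any? (λ y₁ → (y₁ ∈? Y) ×-dec (ψ y₁ ≟ φ y₀))
    ...   | no ∄y₁ = inj₁ (ψ [ y₀ ≔ φ y₀ ] ,
                           extend-match (add-avoid (remove-slot mψ y₀∈Y ψy₀≡j)
                                                   (λ e h eq → ∄y₁ (e , proj₁ (∈-remove⁻ h) , eq)))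
                                        (proj₁ (match mφ) y₀ y₀∈X) (uses mφ y₀ y₀∈X) ⊆-remove-insert)
    ...   | yes (y₁ , y₁∈Y , ψy₁≡φy₀)
      with go (R without j) (X - y₀) (rec (x∈p⇒p-x⊂p y₀∈X)) (Y - y₀)
              (remove-slot mφ y₀∈X refl) (remove-slot mψ y₀∈Y ψy₀≡j) y₁∈Y-y₀ ψy₁≡φy₀
      where
      y₁∈Y-y₀ : y₁ ∈ Y - y₀
      y₁∈Y-y₀ = x∈p∧x≢y⇒x∈p-y y₁∈Y λ { refl → proj₂ (uses mφ y₀ y₀∈X) (trans (sym ψy₁≡φy₀) ψy₀≡j) }
    ... | inj₁ (ψ' , mψ') =
            inj₁ (ψ' [ y₀ ≔ φ y₀ ] , extend-match mψ' y₀∈Cφy₀ (uses mφ y₀ y₀∈X) ⊆-remove-insert)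
      where
      y₀∈Cφy₀ = proj₁ (match mφ) y₀ y₀∈X
    ... | inj₂ (y , y∈Y' , y∉X' , (ρ , mρ) , (ψ' , mψ')) =
            inj₂ (y , proj₁ (∈-remove⁻ y∈Y') , y∉X
                 , (ρ [ y₀ ≔ j ] , extend-match mρ y₀∈Cj Rj insert-remove-swap)
                 , (ψ' [ y₀ ≔ φ y₀ ] , extend-match mψ' y₀∈Cφy₀ (uses mφ y₀ y₀∈X) Y-y⊆))
      where
      y₀∈Cj = subst (λ t → y₀ ∈ C t) ψy₀≡j (proj₁ (match mψ) y₀ y₀∈Y)
      Rj = subst R ψy₀≡j (uses mψ y₀ y₀∈Y)
      y₀∈Cφy₀ = proj₁ (match mφ) y₀ y₀∈X
      y∉X : y ∉ X
      y∉X y∈X = y∉X' (x∈p∧x≢y⇒x∈p-y y∈X (proj₂ (∈-remove⁻ y∈Y')))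
      Y-y⊆ : Y - y ⊆ ((Y - y₀) - y) ∪ ⁅ y₀ ⁆
      Y-y⊆ = subst (λ W → Y - y ⊆ W ∪ ⁅ y₀ ⁆) (p─x─y≡p─y─x Y y y₀) ⊆-remove-insert

addTo : ∀ {r} → SetSystem r m → Fin r → Fin m → SetSystem r m
addTo P j a = P [ j ≔ P j ∪ ⁅ a ⁆ ]

module _ {r : ℕ} (P : SetSystem r m) (j : Fin r) (a : Fin m) where

  ⪯-addTo : P ⪯ addTo P j a
  ⪯-addTo i {e} h with i ≟ j
  ... | yes refl = subst (e ∈_) (sym (updateAt-updates j P)) (⊆-insert h)
  ... | no i≢j = subst (e ∈_) (sym (updateAt-minimal i j P i≢j)) h

  ∈-addTo-new : a ∈ addTo P j a j
  ∈-addTo-new = subst (a ∈_) (sym (updateAt-updates j P)) ∈-insert-new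

  ∈-addTo⁻ : ∀ {i e} → e ∈ addTo P j a i → e ∈ P i ⊎ (i ≡ j × e ≡ a)
  ∈-addTo⁻ {i} h with i ≟ j
  ... | yes refl = [ inj₁ , (λ e≡a → inj₂ (refl , e≡a)) ] (∈-insert⁻ (subst (_ ∈_) (updateAt-updates j P) h))
  ... | no i≢j = inj₁ (subst (_ ∈_) (updateAt-minimal i j P i≢j) h)

  unadd : ∀ {Z ψ} → Match (addTo P j a) Z ψ → (∀ e → e ∈ Z → ψ e ≡ j → e ≢ a) → Match P Z ψ
  unadd (mem , inj) new-unused = (λ e h → [ (λ e∈Pi → e∈Pi) , (λ (ψe≡j , e≡a) → ⊥-elim (new-unused e h ψe≡j e≡a)) ]
                                           (∈-addTo⁻ (mem e h))) , inj

avoid-slot : ∀ {r} {P : SetSystem r m} {j Z φ} → Z ⊆ ∁ (P j) → Match P Z φ → MatchIn P (Anything without j) Z φ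
avoid-slot {P = P} Z⊆ mφ = mφ ▸ λ e h → tt , λ φe≡j → x∈∁p⇒x∉p (Z⊆ h) (subst (λ t → e ∈ P t) φe≡j (proj₁ mφ e h))

-- Let a be a coloop of M[P] \ P j, i.e. a lies in every
-- basis U of ∁ (P j).  Then adding a to P j does not change the matroid: a
-- matching that sends a to j is repaired by sending a to the slot q it uses in
-- such a basis U, clearing q along an alternating path from U - a.
module _ {r : ℕ} (P : SetSystem r m) (j : Fin r) (a : Fin m)
         (coloop : ∀ U → IsBasisIn (Indep P) (∁ (P j)) U → a ∈ U) where

  private
    absorbed : ∀ {U y} → IsBasisIn (Indep P) (∁ (P j)) U → y ∉ P j → Indep P ((U - a) ∪ ⁅ y ⁆) → y ∈ U
    absorbed {U} {y} basisU y∉Pj ind with basis-of P (∁ (P j)) ((U - a) ∪ ⁅ y ⁆) Uay⊆ ind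
      where
      Uay⊆ : (U - a) ∪ ⁅ y ⁆ ⊆ ∁ (P j)
      Uay⊆ = insert-⊆ (λ h → proj₁ basisU (proj₁ (∈-remove⁻ h))) (x∉p⇒x∈∁p y∉Pj)
    ... | U' , Uay⊆U' , basisU' = basis-absorbs basisU (x∉p⇒x∈∁p y∉Pj) (indep-⊆ {C = P} Uy⊆U' (proj₁ (proj₂ basisU')))
      where
      Uy⊆U' : U ∪ ⁅ y ⁆ ⊆ U'
      Uy⊆U' = insert-⊆ (λ x∈U → [ (λ h → Uay⊆U' (⊆-insert h)) , (λ { refl → coloop U' basisU' }) ]
                                    (∈-insert⁻ (⊆-remove-insert {y = a} x∈U)))
                       (Uay⊆U' ∈-insert-new)

  module Rematch {U : Subset m} (basisU : IsBasisIn (Indep P) (∁ (P j)) U) where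
    χ = proj₁ (proj₁ (proj₂ basisU))
    q = χ a
    a∈U = coloop U basisU
    mχ : MatchIn P (Anything without j) U χ
    mχ = avoid-slot (proj₁ basisU) (proj₂ (proj₁ (proj₂ basisU)))
    a∈Pq : a ∈ P q
    a∈Pq = proj₁ (match mχ) a a∈U
    q-allowed : (Anything without j) q
    q-allowed = uses mχ a a∈U

    rematch : ∀ Z {ψ} → MatchIn P (Anything without j) (Z - a) ψ → Indep P Z
    rematch Z {ψ} mψ with any? (λ z → (z ∈? Z - a) ×-dec (ψ z ≟ q))
    ... | no ∄z = ψ [ a ≔ q ] , match (extend-match (add-avoid mψ λ e h eq → ∄z (e , h , eq)) a∈Pq q-allowed ⊆-remove-insert)
    ... | yes (z , z∈Z-a , ψz≡q)
      with alternating-path (Anything without j) (U - a) (Z - a) (remove-slot mχ a∈U refl) mψ z∈Z-a ψz≡q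
    ... | inj₁ (ψ' , mψ') = ψ' [ a ≔ q ] , match (extend-match mψ' a∈Pq q-allowed ⊆-remove-insert)
    ... | inj₂ (y , y∈Z-a , y∉U-a , (_ , mρ) , (ψ' , mψ')) with y ∈? P j
    ...   | no y∉Pj = ⊥-elim (y∉U-a (x∈p∧x≢y⇒x∈p-y (absorbed basisU y∉Pj (_ , match mρ)) (proj₂ (∈-remove⁻ y∈Z-a))))
    ...   | yes y∈Pj = (ψ' [ y ≔ j ]) [ a ≔ q ] , match (extend-match mZ-a a∈Pq tt ⊆-remove-insert)
      where
      mZ-a : MatchIn P (Anything without q) (Z - a) (ψ' [ y ≔ j ])
      mZ-a = extend-match (within-weaken (λ ((_ , t≢j) , t≢q) → (tt , t≢q) , t≢j) mψ') y∈Pj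
                          (tt , λ j≡q → proj₂ q-allowed (sym j≡q)) ⊆-remove-insert

  bondy : ∀ Z → Indep (addTo P j a) Z → Indep P Z
  bondy Z (ψ , mψ) with a ∈? Z | ψ a ≟ j
  ... | no a∉Z | _ = ψ , unadd P j a mψ (λ { e e∈Z _ refl → a∉Z e∈Z })
  ... | yes _ | no ψa≢j = ψ , unadd P j a mψ (λ { e _ ψe≡j refl → ψa≢j ψe≡j })
  ... | yes a∈Z | yes ψa≡j with basis-of P (∁ (P j)) ∅ (⊆-min _) (ψ , (λ e h → ⊥-elim (∉⊥ h)) , λ e f h → ⊥-elim (∉⊥ h))
  ...   | U , _ , basisU = Rematch.rematch basisU Z (unadd P j a (match mZ-a) (λ e h _ → proj₂ (∈-remove⁻ h)) ▸ uses mZ-a)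
    where
    mZ-a : MatchIn (addTo P j a) (Anything without j) (Z - a) ψ
    mZ-a = remove-slot (mψ ▸ λ _ _ → tt) a∈Z ψa≡j

module _ {r n : ℕ} {C : SetSystem r n} where

  x∈^⁺ : ∀ {K i} → i ∈ K → xElt ∈ (C ^ K) i
  x∈^⁺ {K} {i} i∈K = lookup⇒[]= zero (lookup K i ∷ C i) ([]=⇒lookup i∈K)

  x∈^⁻ : ∀ {K i} → xElt ∈ (C ^ K) i → i ∈ K
  x∈^⁻ {K} {i} h = lookup⇒[]= i K ([]=⇒lookup h)

  ^-monoˡ : ∀ {K K'} → K ⊆ K' → (C ^ K) ⪯ (C ^ K')
  ^-monoˡ K⊆K' i {zero} h = x∈^⁺ (K⊆K' (x∈^⁻ h))
  ^-monoˡ K⊆K' i {suc e} (there h) = there h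

  rematch-x : ∀ {K K' Z ρ} → Match (C ^ K) Z ρ → (xElt ∈ Z → ρ xElt ∈ K') → Match (C ^ K') Z ρ
  rematch-x {K} {K'} {Z} {ρ} (mem , inj) x-slot = mem' , inj
    where
    mem' : ∀ e → e ∈ Z → e ∈ (C ^ K') (ρ e)
    mem' zero h = x∈^⁺ (x-slot h)
    mem' (suc e) h with mem (suc e) h
    ... | there h' = there h'

^-monoʳ : ∀ {r n} {C D : SetSystem r n} K → C ⪯ D → (C ^ K) ⪯ (D ^ K)
^-monoʳ K C⪯D i = s⊆s (C⪯D i)

drop-x : ∀ {r n} {C : SetSystem r n} {K b T} → Indep (C ^ K) (b ∷ T) → Indep C T
drop-x (φ , mem , inj) = (λ e → φ (suc e)) , (λ e h → drop-there (mem (suc e) (there h)))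
  , λ e f he hf eq → suc-injective (inj (suc e) (suc f) (there he) (there hf) eq)

add-x : ∀ {r n} {C : SetSystem r n} {K b T} → xElt ∉ (b ∷ T) → Fin r → Indep C T → Indep (C ^ K) (b ∷ T)
add-x {C = C} {K} {b} {T} x∉ d (φ , mem , inj) = (d ∷ᶠ φ) , mem' , inj'
  where
  mem' : ∀ e → e ∈ (b ∷ T) → e ∈ (C ^ K) ((d ∷ᶠ φ) e)
  mem' zero h = ⊥-elim (x∉ h)
  mem' (suc e) h = there (mem e (drop-there h))
  inj' : ∀ e f → e ∈ (b ∷ T) → f ∈ (b ∷ T) → (d ∷ᶠ φ) e ≡ (d ∷ᶠ φ) f → e ≡ f
  inj' zero _ h _ _ = ⊥-elim (x∉ h)
  inj' (suc e) zero _ h _ = ⊥-elim (x∉ h)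
  inj' (suc e) (suc f) he hf eq = cong suc (inj e f (drop-there he) (drop-there hf) eq)

x-free-transfer : ∀ {r n} {C D : SetSystem r n} {K K'} → (∀ T → Indep D T → Indep C T)
  → ∀ Z → xElt ∉ Z → Indep (D ^ K) Z → Indep (C ^ K') Z
x-free-transfer {C = C} {D} {K} {K'} D⇒C (b ∷ T) x∉Z ind =
  add-x {C = C} {K'} x∉Z (proj₁ ind zero) (D⇒C T (drop-x {C = D} {K} ind))

Del : ∀ {r n} → SetSystem r n → Fin r → Subset (suc n)
Del C k = ∁ (outside ∷ C k)

x∈Del : ∀ {r n} {C : SetSystem r n} {k} → xElt ∈ Del C k
x∈Del = here

-- x is spanned in M[C ^ I] \ C k: some x-free independent set of the
-- deletion becomes dependent when x is added.  Constructively this is how x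
-- fails to be a coloop of the deletion.

XSpanned : ∀ {r n} → SetSystem r n → Subset r → Fin r → Set
XSpanned {n = n} C I k = Σ (Subset (suc n)) λ Z →
  Z ⊆ Del C k × xElt ∉ Z × Indep (C ^ I) Z × ¬ Indep (C ^ I) (Z ∪ ⁅ xElt ⁆)

module _ {r n : ℕ} {C : SetSystem r n} {I : Subset r} {k : Fin r} where

  private
    Basis = IsBasisIn (Indep (C ^ I)) (Del C k)

  basis-spans : ∀ {X} → Basis X → xElt ∉ X → XSpanned C I k
  basis-spans {X} basisX x∉X = X , proj₁ basisX , x∉X , proj₁ (proj₂ basisX) , λ ind → x∉X (basis-absorbs basisX (x∈Del {C = C} {k}) ind)

  spanned-basis : XSpanned C I k → Σ (Subset (suc n)) λ X → Basis X × xElt ∉ X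
  spanned-basis (Z , Z⊆ , _ , indZ , depZx) with basis-of (C ^ I) (Del C k) Z Z⊆ indZ
  ... | X , Z⊆X , basisX = X , basisX , λ x∈X → depZx (indep-⊆ {C = C ^ I} (insert-⊆ Z⊆X x∈X) (proj₁ (proj₂ basisX)))

  spanned⇒¬coloop : XSpanned C I k → ¬ XColoopDel C I k
  spanned⇒¬coloop w (_ , in-every-basis) =
    let X , basisX , x∉X = spanned-basis w in x∉X (in-every-basis X basisX)

  ¬coloop⇒¬¬spanned : ¬ XColoopDel C I k → ¬ ¬ XSpanned C I k
  ¬coloop⇒¬¬spanned ¬col ¬w = ¬col (x∈Del {C = C} {k} , in-every-basis)
    where
    in-every-basis : ∀ X → Basis X → xElt ∈ X
    in-every-basis X basisX with xElt ∈? X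
    ... | yes x∈X = x∈X
    ... | no x∉X = ⊥-elim (¬w (basis-spans basisX x∉X))

¬coloop-transfer : ∀ {r n r' n'} {C : SetSystem r n} {C' : SetSystem r' n'} {I k I' k'}
  → (XSpanned C I k → XSpanned C' I' k') → ¬ XColoopDel C I k → ¬ XColoopDel C' I' k'
¬coloop-transfer {C = C} {C'} {I} {k} {I'} {k'} f ¬col col' =
  ¬coloop⇒¬¬spanned {C = C} {I} {k} ¬col λ w → spanned⇒¬coloop {C = C'} {I'} {k'} (f w) col'

¬coloop-transfer₂ : ∀ {r n} {C : SetSystem r n} {I J K k}
  → (XSpanned C I k → XSpanned C J k → XSpanned C K k)
  → ¬ XColoopDel C I k → ¬ XColoopDel C J k → ¬ XColoopDel C K k
¬coloop-transfer₂ {C = C} {I} {J} {K} {k} f ¬colI ¬colJ colK =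
  ¬coloop⇒¬¬spanned {C = C} {I} {k} ¬colI λ wI →
  ¬coloop⇒¬¬spanned {C = C} {J} {k} ¬colJ λ wJ → spanned⇒¬coloop {C = C} {K} {k} (f wI wJ) colK

InL⇒¬coloop : ∀ {r n} {C : SetSystem r n} {I} → InL C I → ∀ k → k ∉ I → ¬ XColoopDel C I k
InL⇒¬coloop inL k k∉I col = k∉I (Equivalence.to (inL k) (inj₂ (k∉I , col)))

¬coloop⇒InL : ∀ {r n} {C : SetSystem r n} {I} → (∀ k → k ∉ I → ¬ XColoopDel C I k) → InL C I
¬coloop⇒InL ¬col k = mk⇔ [ (λ k∈I → k∈I) , (λ (k∉I , col) → ⊥-elim (¬col k k∉I col)) ] inj₁

-- L_B ⊆ L_A when A ⪯ B present the same matroid: a spanning witness for B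
-- lies in the larger deletion for A, is still independent (it avoids x) and
-- still spans x, since A ^ I ⪯ B ^ I.

module _ {r n : ℕ} {A B : SetSystem r n} (B⇒A : ∀ T → Indep B T → Indep A T) (A⪯B : A ⪯ B) where

  spanned-⪯ : ∀ {I k} → XSpanned B I k → XSpanned A I k
  spanned-⪯ {I} {k} (Z , Z⊆ , x∉Z , indZ , depZx) =
    Z , (λ h → p⊆q⇒∁p⊇∁q (s⊆s (A⪯B k)) (Z⊆ h)) , x∉Z , x-free-transfer {C = A} {B} {I} {I} B⇒A Z x∉Z indZ
      , λ ind → depZx (indep-mono (^-monoʳ I A⪯B) ind)

  ¬coloop-⪯ : ∀ {I k} → ¬ XColoopDel B I k → ¬ XColoopDel A I k
  ¬coloop-⪯ {I} {k} = ¬coloop-transfer {C = B} {A} {I} {k} {I} {k} (spanned-⪯ {I} {k})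

  L-⪯ : ∀ {I} → InL B I → InL A I
  L-⪯ {I} inL = ¬coloop⇒InL {C = A} λ k k∉I → ¬coloop-⪯ {I} {k} (InL⇒¬coloop {C = B} inL k k∉I)

module _ {r n : ℕ} {B : SetSystem r n} where

  -- L_B is closed under meets: shrinking I only removes x from sets, so a
  -- spanning witness for I is one for any K ⊆ I.
  spanned-shrink : ∀ {I K k} → K ⊆ I → XSpanned B I k → XSpanned B K k
  spanned-shrink {I} {K} K⊆I (Z , Z⊆ , x∉Z , indZ , depZx) =
    Z , Z⊆ , x∉Z , x-free-transfer {C = B} {B} {I} {K} (λ _ ind → ind) Z x∉Z indZ
      , λ ind → depZx (indep-mono {C = B ^ K} (^-monoˡ {C = B} K⊆I) ind)

  L-meet : ∀ {I J} → InL B I → InL B J → InL B (I ∩ J)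
  L-meet {I} {J} inI inJ = ¬coloop⇒InL ¬col
    where
    ¬col : ∀ k → k ∉ I ∩ J → ¬ XColoopDel B (I ∩ J) k
    ¬col k k∉I∩J with k ∈? I
    ... | no k∉I = ¬coloop-transfer {C = B} {B} {I} {k} {I ∩ J} {k} (spanned-shrink (p∩q⊆p I J)) (InL⇒¬coloop inI k k∉I)
    ... | yes k∈I = ¬coloop-transfer {C = B} {B} {J} {k} {I ∩ J} {k} (spanned-shrink (p∩q⊆q I J))
                      (InL⇒¬coloop inJ k λ k∈J → k∉I∩J (x∈p∩q⁺ (k∈I , k∈J)))

  -- Take a basis X of the deletion in B ^ I that
  -- avoids x, and a witness Z for J.  If X ∪ {x} were matched into B ^ (I ∪ J),
  -- x would use a slot j; if j ∈ I this contradicts maximality of X, and if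
  -- j ∈ J an alternating path from X to Z either makes Z ∪ {x} independent in
  -- B ^ J or adds an element of Z to X, both impossible.
  module Join {I J k X Z ψ} (basisX : IsBasisIn (Indep (B ^ I)) (Del B k) X) (x∉X : xElt ∉ X)
    (Z⊆ : Z ⊆ Del B k) (x∉Z : xElt ∉ Z) (mψ : Match (B ^ J) Z ψ) (depZx : ¬ Indep (B ^ J) (Z ∪ ⁅ xElt ⁆)) where

    module ViaJ {ρ} (mρ : Match (B ^ (I ∪ J)) (X ∪ ⁅ xElt ⁆) ρ) (ρx∈J : ρ xElt ∈ J) where

      j = ρ xElt

      X⊆ : X ⊆ (X ∪ ⁅ xElt ⁆) - xElt
      X⊆ h = x∈p∧x≢y⇒x∈p-y {p = X ∪ ⁅ xElt ⁆} {y = xElt} (⊆-insert {y = xElt} h) λ { refl → x∉X h }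

      mX : MatchIn (B ^ (I ∪ J)) (Anything without j) X ρ
      mX = within-⊆ X⊆ (remove-slot (mρ ▸ λ _ _ → tt) ∈-insert-new refl)

      mZ : MatchIn (B ^ (I ∪ J)) Anything Z ψ
      mZ = rematch-x {C = B} {J} {I ∪ J} mψ (λ x∈Z → ⊥-elim (x∉Z x∈Z)) ▸ λ _ _ → tt

      -- Z ∪ {x} is dependent in B ^ J, so every matching of Z into B ^ J uses j.
      uses-j : ∀ {φ} → MatchIn (B ^ (I ∪ J)) (Anything without j) Z φ → ⊥
      uses-j {φ} mφ = depZx (φ [ xElt ≔ j ] , match (extend-match mφJ (x∈^⁺ {C = B} ρx∈J) tt ⊆-refl))
        where
        mφJ : MatchIn (B ^ J) (Anything without j) Z φ
        mφJ = rematch-x {C = B} {I ∪ J} {J} (match mφ) (λ x∈Z → ⊥-elim (x∉Z x∈Z)) ▸ uses mφ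

      contradiction : ⊥
      contradiction with any? (λ y₀ → (y₀ ∈? Z) ×-dec (ψ y₀ ≟ j))
      ... | no ∄y₀ = uses-j (add-avoid mZ λ e h eq → ∄y₀ (e , h , eq))
      ... | yes (y₀ , y₀∈Z , ψy₀≡j) with alternating-path Anything X Z mX mZ y₀∈Z ψy₀≡j
      ... | inj₁ (_ , mψ') = uses-j mψ'
      ... | inj₂ (y , y∈Z , y∉X , (ρ' , mρ') , _) =
              y∉X (basis-absorbs basisX (Z⊆ y∈Z) (ρ' , rematch-x {C = B} {I ∪ J} {I} (match mρ') x-free))
        where
        x-free : xElt ∈ X ∪ ⁅ y ⁆ → ρ' xElt ∈ I
        x-free h = ⊥-elim ([ x∉X , (λ x≡y → x∉Z (subst (_∈ Z) (sym x≡y) y∈Z)) ] (∈-insert⁻ h))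

    dependent : ¬ Indep (B ^ (I ∪ J)) (X ∪ ⁅ xElt ⁆)
    dependent (ρ , mρ) with x∈p∪q⁻ I J (x∈^⁻ {C = B} {I ∪ J} (proj₁ mρ xElt ∈-insert-new))
    ... | inj₁ ρx∈I = x∉X (basis-absorbs basisX (x∈Del {C = B} {k}) (ρ , rematch-x {C = B} {I ∪ J} {I} mρ (λ _ → ρx∈I)))
    ... | inj₂ ρx∈J = ViaJ.contradiction mρ ρx∈J

    witness : XSpanned B (I ∪ J) k
    witness = X , proj₁ basisX , x∉X
      , x-free-transfer {C = B} {B} {I} {I ∪ J} (λ _ ind → ind) X x∉X (proj₁ (proj₂ basisX)) , dependent

  spanned-join : ∀ {I J k} → XSpanned B I k → XSpanned B J k → XSpanned B (I ∪ J) k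
  spanned-join {I} {J} {k} wI (Z , Z⊆ , x∉Z , (ψ , mψ) , depZx) =
    let X , basisX , x∉X = spanned-basis {C = B} {I} {k} wI in Join.witness {I} {J} {k} basisX x∉X Z⊆ x∉Z mψ depZx

  L-join : ∀ {I J} → InL B I → InL B J → InL B (I ∪ J)
  L-join {I} {J} inI inJ = ¬coloop⇒InL λ k k∉I∪J →
    ¬coloop-transfer₂ {C = B} {I} {J} {I ∪ J} {k} (spanned-join {I} {J} {k})
      (InL⇒¬coloop inI k (λ k∈I → k∉I∪J (x∈p∪q⁺ (inj₁ k∈I))))
      (InL⇒¬coloop inJ k (λ k∈J → k∉I∪J (x∈p∪q⁺ (inj₂ k∈J))))

module _ {r n : ℕ} {C : SetSystem r n} {I : Subset r} {j : Fin r} {e : Fin n} where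

  ^-addTo⁺ : (addTo C j e ^ I) ⪯ addTo (C ^ I) j (suc e)
  ^-addTo⁺ i {zero} h = ⪯-addTo (C ^ I) j (suc e) i (x∈^⁺ {C = C} {I} (x∈^⁻ {C = addTo C j e} {I} h))
  ^-addTo⁺ i {suc f} (there h) with ∈-addTo⁻ C j e h
  ... | inj₁ f∈Ci = ⪯-addTo (C ^ I) j (suc e) i (there f∈Ci)
  ... | inj₂ (refl , refl) = ∈-addTo-new (C ^ I) j (suc e)

  ^-addTo⁻ : addTo (C ^ I) j (suc e) ⪯ (addTo C j e ^ I)
  ^-addTo⁻ i h with ∈-addTo⁻ (C ^ I) j (suc e) h
  ... | inj₁ h' = ^-monoʳ I (⪯-addTo C j e) i h'
  ... | inj₂ (refl , refl) = there (∈-addTo-new C j e)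

-- Let D = addTo C j₀ e₀ with
-- e₀ ∉ C j₀ and M[D] = M[C], and let I ∈ L_D.  Then M[D ^ I] = M[C ^ I]: by
-- Bondy's lemma applied to P = C ^ I and the element e₀, it suffices that
-- e₀ lies in every basis of ∁ (P j₀).  When j₀ ∈ I such bases avoid x; when
-- j₀ ∉ I a basis missing e₀ would contradict x not being a coloop of
-- M[D ^ I] \ D j₀.

module Step {r n : ℕ} (C : SetSystem r n) (j₀ : Fin r) (e₀ : Fin n) (e₀∉Cj₀ : e₀ ∉ C j₀)
  (D⇒C : ∀ T → Indep (addTo C j₀ e₀) T → Indep C T) (I : Subset r)
  (¬colD : ∀ k → k ∉ I → ¬ XColoopDel (addTo C j₀ e₀) I k) where

  D = addTo C j₀ e₀
  P = C ^ I
  Q = addTo P j₀ (suc e₀)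
  Basis = IsBasisIn (Indep P) (∁ (P j₀))

  e₀∉Pj₀ : suc e₀ ∉ P j₀
  e₀∉Pj₀ h = e₀∉Cj₀ (drop-there h)

  Q⇒P : ∀ Z → xElt ∉ Z → Indep Q Z → Indep P Z
  Q⇒P Z x∉Z ind = x-free-transfer {C = C} {D} {I} {I} D⇒C Z x∉Z (indep-mono (^-addTo⁻ {C = C} {I} {j₀} {e₀}) ind)

  χ : ∀ {U} → Basis U → Fin (suc n) → Fin r
  χ basisU = proj₁ (proj₁ (proj₂ basisU))

  basis-in-Q : ∀ {U} (basisU : Basis U) → MatchIn Q (Anything without j₀) U (χ basisU)
  basis-in-Q basisU = match-mono (⪯-addTo P j₀ (suc e₀)) (proj₂ (proj₁ (proj₂ basisU)))
    ▸ uses (avoid-slot {P = P} {j₀} (proj₁ basisU) (proj₂ (proj₁ (proj₂ basisU))))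

  basis+e₀ : ∀ {U} (basisU : Basis U) → MatchIn Q Anything (U ∪ ⁅ suc e₀ ⁆) (χ basisU [ suc e₀ ≔ j₀ ])
  basis+e₀ basisU = extend-match (basis-in-Q basisU) (∈-addTo-new P j₀ (suc e₀)) tt ⊆-refl

  e₀∈x-free-basis : ∀ {U} → Basis U → xElt ∉ U → suc e₀ ∈ U
  e₀∈x-free-basis {U} basisU x∉U =
    basis-absorbs basisU (x∉p⇒x∈∁p e₀∉Pj₀) (Q⇒P _ x∉Ue₀ (_ , match (basis+e₀ basisU)))
    where
    x∉Ue₀ : xElt ∉ U ∪ ⁅ suc e₀ ⁆
    x∉Ue₀ h = [ x∉U , (λ ()) ] (∈-insert⁻ {y = suc e₀} h)

  x-free-in-∁Pj₀ : ∀ {Z} → Z ⊆ Del D j₀ → xElt ∉ Z → Z ⊆ ∁ (P j₀)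
  x-free-in-∁Pj₀ Z⊆ x∉Z {zero} h = ⊥-elim (x∉Z h)
  x-free-in-∁Pj₀ Z⊆ x∉Z {suc f} h = there (drop-there (p⊆q⇒∁p⊇∁q (s⊆s (⪯-addTo C j₀ e₀ j₀)) (Z⊆ h)))

  -- When j₀ ∉ I, a basis U of ∁ (P j₀) missing e₀ rules out every spanning
  -- witness Z for x in M[D ^ I] \ D j₀.  Let W ⊇ Z be a basis of ∁ (P j₀);
  -- W avoids x, so it contains e₀, and an alternating path in Q from W to
  -- U ∪ {e₀} either puts e₀ into U or enlarges W or makes Z ∪ {x} independent.
  module NoWitness {U} (basisU : Basis U) (e₀∉U : suc e₀ ∉ U) {Z} (x∉Z : xElt ∉ Z)
    (depZx : ¬ Indep (D ^ I) (Z ∪ ⁅ xElt ⁆)) {W} (Z⊆W : Z ⊆ W) (basisW : Basis W) where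

    x∉W : xElt ∉ W
    x∉W x∈W = depZx (indep-mono (^-monoʳ I (⪯-addTo C j₀ e₀))
                      (indep-⊆ {C = P} (insert-⊆ Z⊆W x∈W) (proj₁ (proj₂ basisW))))

    Ue₀⊆∁Pj₀ : U ∪ ⁅ suc e₀ ⁆ ⊆ ∁ (P j₀)
    Ue₀⊆∁Pj₀ = insert-⊆ (proj₁ basisU) (x∉p⇒x∈∁p e₀∉Pj₀)

    rematched : IndepIn Q (Anything without j₀) (U ∪ ⁅ suc e₀ ⁆) → ⊥
    rematched (ψ , mψ) = e₀∉U (basis-absorbs basisU (x∉p⇒x∈∁p e₀∉Pj₀)
      (ψ , unadd P j₀ (suc e₀) (match mψ) λ e h ψe≡j₀ _ → proj₂ (uses mψ e h) ψe≡j₀))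

    augmented : ∀ {y} → y ∈ U ∪ ⁅ suc e₀ ⁆ → y ∉ W → IndepIn Q Anything (W ∪ ⁅ y ⁆) → ⊥
    augmented {y} y∈Ue₀ y∉W (ρ , mρ) with y ≟ xElt
    ... | yes y≡x = depZx (indep-mono (^-addTo⁻ {C = C} {I} {j₀} {e₀}) (indep-⊆ {C = Q} Zx⊆Wy (ρ , match mρ)))
      where
      Zx⊆Wy : Z ∪ ⁅ xElt ⁆ ⊆ W ∪ ⁅ y ⁆
      Zx⊆Wy = insert-⊆ (λ h → ⊆-insert (Z⊆W h)) (subst (_∈ W ∪ ⁅ y ⁆) y≡x ∈-insert-new)
    ... | no y≢x = y∉W (basis-absorbs basisW (Ue₀⊆∁Pj₀ y∈Ue₀) (Q⇒P _ x∉Wy (ρ , match mρ)))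
      where
      x∉Wy : xElt ∉ W ∪ ⁅ y ⁆
      x∉Wy h = [ x∉W , (λ x≡y → y≢x (sym x≡y)) ] (∈-insert⁻ h)

    contradiction : ⊥
    contradiction = [ rematched , (λ (_ , y∈Ue₀ , y∉W , indWy , _) → augmented y∈Ue₀ y∉W indWy) ]
      (alternating-path Anything W (U ∪ ⁅ suc e₀ ⁆) (basis-in-Q basisW) (basis+e₀ basisU)
                        (∈-insert-new {y = suc e₀}) (updateAt-updates (suc e₀) (χ basisU)))

  e₀-coloop : ∀ U → Basis U → suc e₀ ∈ U
  e₀-coloop U basisU with j₀ ∈? I
  ... | yes j₀∈I = e₀∈x-free-basis basisU λ x∈U → x∈∁p⇒x∉p (proj₁ basisU x∈U) (x∈^⁺ {C = C} {I} j₀∈I)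
  ... | no j₀∉I with suc e₀ ∈? U
  ...   | yes e₀∈U = e₀∈U
  ...   | no e₀∉U = ⊥-elim (¬coloop⇒¬¬spanned {C = D} {I} {j₀} (¬colD j₀ j₀∉I) no-witness)
    where
    no-witness : ¬ XSpanned D I j₀
    no-witness (Z , Z⊆ , x∉Z , indZ , depZx)
      with basis-of P (∁ (P j₀)) Z (x-free-in-∁Pj₀ Z⊆ x∉Z) (x-free-transfer {C = C} {D} {I} {I} D⇒C Z x∉Z indZ)
    ... | W , Z⊆W , basisW = NoWitness.contradiction basisU e₀∉U x∉Z depZx Z⊆W basisW

  step : ∀ Z → Indep (D ^ I) Z → Indep (C ^ I) Z
  step Z ind = bondy P j₀ (suc e₀) e₀-coloop Z (indep-mono (^-addTo⁺ {C = C} {I} {j₀} {e₀}) ind)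

weight : ∀ {r n} → SetSystem r n → ℕ
weight {zero} C = 0
weight {suc r} C = ∣ C zero ∣ + weight (λ i → C (suc i))

weight-mono : ∀ {r n} {C D : SetSystem r n} → C ⪯ D → weight C ≤ weight D
weight-mono {zero} C⪯D = ℕₚ.≤-refl
weight-mono {suc r} C⪯D = ℕₚ.+-mono-≤ (p⊆q⇒∣p∣≤∣q∣ (C⪯D zero)) (weight-mono (λ i → C⪯D (suc i)))

weight-mono-< : ∀ {r n} {C D : SetSystem r n} → C ⪯ D → ∀ j → C j ⊂ D j → weight C < weight D
weight-mono-< C⪯D zero C⊂D = ℕₚ.+-mono-<-≤ (p⊂q⇒∣p∣<∣q∣ C⊂D) (weight-mono (λ i → C⪯D (suc i)))
weight-mono-< C⪯D (suc j) C⊂D = ℕₚ.+-mono-≤-< (p⊆q⇒∣p∣≤∣q∣ (C⪯D zero)) (weight-mono-< (λ i → C⪯D (suc i)) j C⊂D)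

-- Interpolate between A and B by adding
-- the missing elements one at a time; every intermediate system presents
-- the same matroid and, by ¬coloop-⪯, still has I in its lattice, so each
-- addition is a Step.

module _ {r n : ℕ} {B : SetSystem r n} {I : Subset r} (¬colB : ∀ k → k ∉ I → ¬ XColoopDel B I k) where

  interpolate : ∀ A → A ⪯ B → (∀ T → Indep B T → Indep A T) → ∀ Z → Indep (B ^ I) Z → Indep (A ^ I) Z
  interpolate A = go A (<-wellFounded (weight B ∸ weight A))
    where
    go : ∀ A → Acc _<_ (weight B ∸ weight A) → A ⪯ B → (∀ T → Indep B T → Indep A T)
      → ∀ Z → Indep (B ^ I) Z → Indep (A ^ I) Z
    go A (acc rec) A⪯B B⇒A Z ind with any? (λ j → any? (λ e → (e ∈? B j) ×-dec ¬? (e ∈? A j)))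
    ... | no ∄e = indep-mono (^-monoʳ I B⪯A) ind
      where
      B⪯A : B ⪯ A
      B⪯A j {e} e∈Bj with e ∈? A j
      ... | yes e∈Aj = e∈Aj
      ... | no e∉Aj = ⊥-elim (∄e (j , e , e∈Bj , e∉Aj))
    ... | yes (j , e , e∈Bj , e∉Aj) =
            Step.step A j e e∉Aj D⇒A I ¬colD Z (go D (rec closer) D⪯B B⇒D Z ind)
      where
      D = addTo A j e
      D⪯B : D ⪯ B
      D⪯B i h = [ A⪯B i , (λ { (refl , refl) → e∈Bj }) ] (∈-addTo⁻ A j e h)
      B⇒D : ∀ T → Indep B T → Indep D T
      B⇒D T ind = indep-mono (⪯-addTo A j e) (B⇒A T ind)
      D⇒A : ∀ T → Indep D T → Indep A T
      D⇒A T ind = B⇒A T (indep-mono D⪯B ind)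
      ¬colD : ∀ k → k ∉ I → ¬ XColoopDel D I k
      ¬colD k k∉I = ¬coloop-⪯ B⇒D D⪯B {I} {k} (¬colB k k∉I)
      closer : weight B ∸ weight D < weight B ∸ weight A
      closer = ℕₚ.∸-monoʳ-< (weight-mono-< (⪯-addTo A j e) j (⪯-addTo A j e j , e , ∈-addTo-new A j e , e∉Aj))
                            (weight-mono D⪯B)

theorem3p2 : ∀ {r n} (𝒜 ℬ : SetSystem r n) → HasRank 𝒜 r → SameMatroid 𝒜 ℬ → 𝒜 ⪯ ℬ →
    ((∀ I → InL ℬ I → InL 𝒜 I) × (∀ I J → InL ℬ I → InL ℬ J → InL ℬ (I ∪ J) × InL ℬ (I ∩ J)))
    × (∀ I → InL ℬ I → SameMatroid (𝒜 ^ I) (ℬ ^ I))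
theorem3p2 𝒜 ℬ _ same 𝒜⪯ℬ =
  ( (λ I → L-⪯ ℬ⇒𝒜 𝒜⪯ℬ)
  , (λ I J inI inJ → L-join inI inJ , L-meet inI inJ) )
  , λ I inL X → mk⇔ (indep-mono (^-monoʳ I 𝒜⪯ℬ)) (interpolate (InL⇒¬coloop inL) 𝒜 𝒜⪯ℬ ℬ⇒𝒜 X)
  where
  ℬ⇒𝒜 : ∀ T → Indep ℬ T → Indep 𝒜 T
  ℬ⇒𝒜 T = Equivalence.from (same T)
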